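{- Let $\Gamma$ be a connected graph, let $G$ be an arc-transitive subgroup of $\mathrm{Aut}(\Gamma)$, and let $r \geq 1$. Let $\alpha = (v_0, \ldots, v_r)$ be a $G$-consistent walk with a shunt $g \in \mathrm{Sh}_G(\alpha)$. For every $n \in \{1, \ldots, r\}$ let $\alpha_n = (v_0, \ldots, v_n)$ and $k_n = |\mathrm{Succ}_G(\alpha_n)|$. Suppose that $G_\alpha$ fixes every element of $\mathrm{Succ}_G(\alpha)$, and that for every $n \in \{1, \ldots, r-1\}$ at least one of the following holds: (a) there is no integer $i$ with $k_{n+1} \leq i < k_n$ and $i \mid k_n$; (b) the group $\langle G_{\alpha_n}, G_{\alpha_n^g} \rangle$ acts transitively on $\mathrm{Succ}_G(\alpha_n)$; (c) $\langle G_{\alpha_n}, G_{\alpha_n^g} \rangle = G_{(v_1, \ldots, v_n)}$. Then $G_\alpha = 1$.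
   Context: All graphs are finite and simple with at least three vertices. Automorphisms act on the right, $x \mapsto x^g$, and act on tuples of vertices coordinatewise (so $\alpha_n^g = (v_1, \ldots, v_{n+1})$ here); for a tuple $\beta$ of vertices, $G_\beta$ denotes the subgroup of $G$ fixing every entry of $\beta$. An arc is a pair of adjacent vertices; $G$ is arc-transitive if it is transitive on arcs. A walk of length $n \geq 1$ is a tuple $(v_0, \ldots, v_n)$ of vertices in which any two consecutive vertices are adjacent. For $G \leq \mathrm{Aut}(\Gamma)$, a walk $\alpha = (v_0, \ldots, v_n)$ is $G$-consistent if there exists $g \in G$ (a shunt of $\alpha$) with $v_i^g = v_{i+1}$ for all $i \in \{0, \ldots, n-1\}$; $\mathrm{Sh}_G(\alpha)$ is the set of such shunts. For a $G$-consistent walk $\alpha = (v_0, \ldots, v_n)$, a walk $(v_1, \ldots, v_n, v_{n+1})$ is a $G$-successor of $\alpha$ if there is $g \in \mathrm{Sh}_G(\alpha)$ with $v_n^g = v_{n+1}$; $\mathrm{Succ}_G(\alpha)$ is the set of $G$-successors of $\alpha$. -}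

module Defs where

open import Data.Nat using (ℕ; zero; suc; _≤_; _<_)
open import Data.Fin using (Fin; toℕ; fromℕ)
open import Data.Fin.Permutation using (Permutation′; _⟨$⟩ʳ_; _∘ₚ_; flip; id)
open import Data.Vec using (Vec; lookup)
open import Data.List using (List; length)
open import Data.List.Relation.Unary.Unique.Propositional using (Unique)
open import Data.List.Membership.Propositional using (_∈_)
open import Data.Product using (Σ; ∃; _×_; _,_)
open import Data.Sum using (_⊎_)
open import Data.Empty using (⊥)
open import Relation.Nullary using (¬_)
open import Relation.Binary.PropositionalEquality using (_≡_)
open import Relation.Binary.Construct.Closure.ReflexiveTransitive using (Star)
open import Function.Bundles using (_⇔_)

record Graph : Set₁ where
  field
    N     : ℕ
    three : 3 ≤ N
    Adj   : Fin N → Fin N → Set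
    sym   : ∀ {x y} → Adj x y → Adj y x
    irr   : ∀ {x} → ¬ Adj x x

module _ (Γ : Graph) where
  open Graph Γ

  Connected : Set
  Connected = ∀ x y → Star Adj x y

  Perm : Set
  Perm = Permutation′ N

  infixl 8 _^_
  _^_ : Fin N → Perm → Fin N
  x ^ g = g ⟨$⟩ʳ x

  IsAut : Perm → Set
  IsAut g = ∀ x y → Adj x y ⇔ Adj (x ^ g) (y ^ g)

  _≈_ : Perm → Perm → Set
  g ≈ h = ∀ x → x ^ g ≡ x ^ h

  record IsAutSubgroup (G : Perm → Set) : Set where
    field
      aut    : ∀ g → G g → IsAut g
      resp   : ∀ g h → g ≈ h → G g → G h
      hasId  : G id
      closed : ∀ g h → G g → G h → G (g ∘ₚ h)
      inv    : ∀ g → G g → G (flip g)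

  ArcTransitive : (Perm → Set) → Set
  ArcTransitive G = ∀ x y x' y' → Adj x y → Adj x' y' →
                    ∃ λ g → G g × (x ^ g ≡ x') × (y ^ g ≡ y')

  -- Walks.  A walk (v₀,…,vₙ) is encoded by a sequence v : ℕ → Fin N
  -- together with its length n (only the entries v 0 … v n matter).

  IsWalk : (ℕ → Fin N) → ℕ → Set
  IsWalk v n = ∀ i → i < n → Adj (v i) (v (suc i))

  Shunt : (Perm → Set) → (ℕ → Fin N) → ℕ → Perm → Set
  Shunt G v n g = G g × (∀ i → i < n → v i ^ g ≡ v (suc i))

  Consistent : (Perm → Set) → (ℕ → Fin N) → ℕ → Set
  Consistent G v n = ∃ λ g → Shunt G v n g

  -- G-successors of (v₀,…,vₙ), as (n+1)-tuples (w₀,…,wₙ) = (v₁,…,vₙ,v_{n+1})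
  Succ : (Perm → Set) → (ℕ → Fin N) → (n : ℕ) → Vec (Fin N) (suc n) → Set
  Succ G v n t = ∃ λ g → Shunt G v n g ×
                   (∀ (i : Fin (suc n)) → toℕ i < n → lookup t i ≡ v (suc (toℕ i))) ×
                   (lookup t (fromℕ n) ≡ v n ^ g)

  FixesUpTo : (ℕ → Fin N) → ℕ → Perm → Set
  FixesUpTo v n h = ∀ i → i ≤ n → v i ^ h ≡ v i

  Stab : (Perm → Set) → (ℕ → Fin N) → ℕ → Perm → Set
  Stab G v n h = G h × FixesUpTo v n h

  StabImage : (Perm → Set) → (ℕ → Fin N) → ℕ → Perm → Perm → Set
  StabImage G v n g h = G h × (∀ i → i ≤ n → (v i ^ g) ^ h ≡ v i ^ g)

  StabTail : (Perm → Set) → (ℕ → Fin N) → ℕ → Perm → Set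
  StabTail G v n h = G h × (∀ i → 1 ≤ i → i ≤ n → v i ^ h ≡ v i)

  FixesTuple : ∀ {m} → Vec (Fin N) m → Perm → Set
  FixesTuple {m} t h = ∀ (i : Fin m) → lookup t i ^ h ≡ lookup t i

  data Gen (H K : Perm → Set) : Perm → Set where
    inH   : ∀ {g} → H g → Gen H K g
    inK   : ∀ {g} → K g → Gen H K g
    one   : Gen H K id
    mul   : ∀ {g h} → Gen H K g → Gen H K h → Gen H K (g ∘ₚ h)
    invG  : ∀ {g} → Gen H K g → Gen H K (flip g)
    respG : ∀ {g h} → g ≈ h → Gen H K g → Gen H K h

  TransitiveOn : ∀ {m} → (Perm → Set) → (Vec (Fin N) m → Set) → Set
  TransitiveOn S P = ∀ s t → P s → P t →
                     ∃ λ h → S h × (∀ i → lookup s i ^ h ≡ lookup t i)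

  SameSet : (Perm → Set) → (Perm → Set) → Set
  SameSet H K = ∀ h → H h ⇔ K h

HasSize : {A : Set} → (A → Set) → ℕ → Set
HasSize {A} P k = Σ (List A) λ xs → Unique xs × (∀ a → P a ⇔ a ∈ xs) × (length xs ≡ k)

{-# OPTIONS --safe #-}
module Submission where

-- Write K = G_α and Fix(K) for the set of vertices fixed by K.  The hypothesis on the successors
-- of α gives K ≤ G_{α^g}, i.e. g K g⁻¹ ≤ K, so g maps Fix(K) into itself; by finiteness so does
-- g⁻¹, whence G_{α^g} = K.  Every t ∈ G_{(v₁,…,v_r)} has t K t⁻¹ ≤ G_{α^g} = K, so
-- G_{(v₁,…,v_r)} permutes Fix(K) as well.  Going down from n = r: if G_{(v₁,…,v_{n+1})} permutes
-- Fix(K), then so do its conjugate g G_{(v₁,…,v_{n+1})} g⁻¹ ≥ G_{α_n} and its subgroup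
-- G_{α_n^g}, hence so does M = ⟨G_{α_n}, G_{α_n^g}⟩ ≤ G_{(v₁,…,v_n)}.  Each of (a), (b), (c)
-- gives M = G_{(v₁,…,v_n)}: with p = v_n^g it suffices that p^M = p^{G_{(v₁,…,v_n)}}, because
-- G_{(v₁,…,v_n)} ∩ G_p = G_{α_n^g} ≤ M.  In case (a), p^M is a block for G_{(v₁,…,v_n)} acting
-- on p^{G_{(v₁,…,v_n)}}, a set of size k_n, so |p^M| divides k_n; and |p^M| ≥ k_{n+1}, since p^M
-- contains the g⁻¹-images of the last entries of the G-successors of α_{n+1}; so (a) forces
-- |p^M| = k_n.
-- At n = 1 the stabilisers of both ends of the arc (v₀, v₁) permute Fix(K); arc-transitivity
-- and connectivity carry this along every edge, so Fix(K) is the whole vertex set.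
-- Orbit sizes are counted with decision procedures that exist only under double negation,
-- which is harmless because the final goal x^h ≡ x is decidable.

open import Data.Fin using (Fin; zero; suc; toℕ; fromℕ; _≟_)
open import Data.Fin.Permutation
  using (Permutation′; _⟨$⟩ʳ_; _⟨$⟩ˡ_; _∘ₚ_; flip; id; inverseˡ; inverseʳ)
open import Data.Fin.Properties using (any?; pigeonhole; toℕ-injective; toℕ-fromℕ; toℕ≤pred[n])
open import Data.List using (List; []; _∷_; length; map)
open import Data.List.Membership.Propositional using (_∈_; _∉_)
open import Data.List.Membership.Propositional.Properties using (∈-map⁺; ∈-map⁻)
import Data.List.Membership.DecPropositional as DecMembership
open import Data.List.Properties using (length-map)
import Data.List.Relation.Unary.All as All
open import Data.List.Relation.Unary.All.Properties using (All¬⇒¬Any) renaming (map⁺ to All-map⁺)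
open import Data.List.Relation.Unary.AllPairs using ([]; _∷_)
open import Data.List.Relation.Unary.Any using (here; there)
open import Data.List.Relation.Unary.Unique.Propositional using (Unique)
open import Data.Bool using (if_then_else_)
open import Data.Nat using (ℕ; zero; suc; _+_; _∸_; _≤_; _<_; z≤n; s≤s; _<?_)
open import Data.Nat.Divisibility using (_∣_; _∣0; ∣-refl; ∣m∣n⇒∣m+n)
open import Data.Nat.GeneralisedArithmetic using (fold; fold-+)
open import Data.Nat.Induction using (<-wellFounded)
open import Data.Nat.Properties
  using ( +-0-commutativeMonoid; +-comm; +-suc; +-identityʳ; +-mono-≤; ≤-refl; ≤-antisym
        ; <-trans; <-≤-trans; ≤-<-trans; <⇒≤; ≮⇒≥; n≮n; n<1+n; m≤m+n; m≤n⇒m≤1+n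
        ; m≤n⇒m<n∨m≡n; m+[n∸m]≡n; module ≤-Reasoning)
open import Data.Product using (∃; _×_; _,_; proj₁; proj₂)
open import Data.Sum using (_⊎_; inj₁; inj₂)
open import Data.Vec using (Vec; lookup; tabulate)
open import Data.Vec.Properties using (lookup∘tabulate; tabulate∘lookup; tabulate-cong)
open import Effect.Monad using (RawMonad)
open import Function using (_∘_)
open import Function.Bundles using (mk⇔; Equivalence)
open import Induction.WellFounded using (Acc; acc)
open import Level using (0ℓ)
open import Relation.Binary.Construct.Closure.ReflexiveTransitive using (Star; ε; _◅_)
open import Relation.Binary.PropositionalEquality
  using (_≡_; refl; sym; trans; cong; cong₂; subst; module ≡-Reasoning)
open import Relation.Nullary using (¬_; Dec; yes; no; does)
open import Relation.Nullary.Decidable using (¬¬-excluded-middle; decidable-stable)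
open import Relation.Nullary.Negation using (DoubleNegation; contradiction; ¬¬-Monad; ¬¬-map)
open import Relation.Unary using (Decidable; _⊆_)
open import Relation.Unary.Properties using (_∩?_; ∁?)
open import Defs hiding (_^_)
import Defs

open import Algebra.Properties.CommutativeMonoid.Sum +-0-commutativeMonoid
  using (sum; sum-cong-≗; sum-permute; ∑-distrib-+; sum-replicate-zero)
open RawMonad (¬¬-Monad {0ℓ}) using (pure; _>>=_)

¬¬-∀-Fin : ∀ {n} {Q : Fin n → Set} → (∀ x → DoubleNegation (Q x)) → DoubleNegation (∀ x → Q x)
¬¬-∀-Fin {zero}  _   k = k λ ()
¬¬-∀-Fin {suc n} ¬¬Q k =
  ¬¬Q zero λ q₀ → ¬¬-∀-Fin (¬¬Q ∘ suc) λ qₛ → k λ { zero → q₀ ; (suc x) → qₛ x }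

¬¬-decidable : ∀ {n} (Q : Fin n → Set) → DoubleNegation (Decidable Q)
¬¬-decidable Q = ¬¬-∀-Fin λ _ → ¬¬-excluded-middle

indicator : {A : Set} → Dec A → ℕ
indicator a = if does a then 1 else 0

count : ∀ {n} {P : Fin n → Set} → Decidable P → ℕ
count P? = sum λ x → indicator (P? x)

indicator-mono : {A B : Set} → (A → B) → (a : Dec A) (b : Dec B) → indicator a ≤ indicator b
indicator-mono A→B (yes a) (yes _) = ≤-refl
indicator-mono A→B (yes a) (no ¬b) = contradiction (A→B a) ¬b
indicator-mono A→B (no _)  _       = z≤n

indicator-cong : {A B : Set} → (A → B) → (B → A) → (a : Dec A) (b : Dec B) →
                 indicator a ≡ indicator b
indicator-cong A→B B→A (yes a) (yes _) = refl
indicator-cong A→B B→A (yes a) (no ¬b) = contradiction (A→B a) ¬b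
indicator-cong A→B B→A (no ¬a) (yes b) = contradiction (B→A b) ¬a
indicator-cong A→B B→A (no _)  (no _)  = refl

module _ {n : ℕ} {P Q : Fin n → Set} (P? : Decidable P) (Q? : Decidable Q) where

  count-cong : P ⊆ Q → Q ⊆ P → count P? ≡ count Q?
  count-cong P⊆Q Q⊆P = sum-cong-≗ λ x → indicator-cong P⊆Q Q⊆P (P? x) (Q? x)

  count-split : Q ⊆ P → count P? ≡ count (P? ∩? ∁? Q?) + count Q?
  count-split Q⊆P =
    trans (sum-cong-≗ pointwise) (∑-distrib-+ (indicator ∘ (P? ∩? ∁? Q?)) (indicator ∘ Q?))
    where
    pointwise : ∀ x → indicator (P? x) ≡ indicator ((P? ∩? ∁? Q?) x) + indicator (Q? x)
    pointwise x with P? x | Q? x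
    ... | yes _ | yes _ = refl
    ... | yes _ | no _  = refl
    ... | no ¬p | yes q = contradiction (Q⊆P q) ¬p
    ... | no _  | no _  = refl

count-mono : ∀ {n} {P Q : Fin n → Set} (P? : Decidable P) (Q? : Decidable Q) →
             P ⊆ Q → count P? ≤ count Q?
count-mono {zero}  _  _  _   = z≤n
count-mono {suc n} P? Q? P⊆Q =
  +-mono-≤ (indicator-mono P⊆Q (P? zero) (Q? zero)) (count-mono (P? ∘ suc) (Q? ∘ suc) P⊆Q)

count-≟ : ∀ {n} (y : Fin n) → count (_≟ y) ≡ 1
count-≟ {suc n} zero    = cong suc (sum-replicate-zero n)
count-≟ {suc n} (suc y) = count-≟ y

count-∅ : ∀ {n} {P : Fin n → Set} (P? : Decidable P) → (∀ x → ¬ P x) → count P? ≡ 0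
count-∅ {n} P? ¬P =
  trans (count-cong P? (λ _ → no λ ()) (λ {x} Px → ¬P x Px) λ ()) (sum-replicate-zero n)

count-mono-< : ∀ {n} {P Q : Fin n → Set} (P? : Decidable P) (Q? : Decidable Q) →
               P ⊆ Q → ∀ {x} → Q x → ¬ P x → count P? < count Q?
count-mono-< P? Q? P⊆Q {x} Qx ¬Px = begin-strict
  count P?                        <⟨ n<1+n _ ⟩
  suc (count P?)                  ≡⟨ +-comm 1 (count P?) ⟩
  count P? + 1                    ≡⟨ cong (count P? +_) (sym (count-≟ x)) ⟩
  count P? + count (_≟ x)         ≤⟨ +-mono-≤ (≤-refl {count P?}) x∈Q∖P ⟩
  count P? + count (Q? ∩? ∁? P?)  ≡⟨ +-comm (count P?) _ ⟩
  count (Q? ∩? ∁? P?) + count P?  ≡⟨ sym (count-split Q? P? P⊆Q) ⟩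
  count Q?                        ∎
  where
  open ≤-Reasoning
  x∈Q∖P : count (_≟ x) ≤ count (Q? ∩? ∁? P?)
  x∈Q∖P = count-mono (_≟ x) (Q? ∩? ∁? P?) λ { refl → Qx , ¬Px }

count-permute : ∀ {n} {P : Fin n → Set} (P? : Decidable P) (π : Permutation′ n) →
                count (λ x → P? (π ⟨$⟩ʳ x)) ≡ count P?
count-permute P? π = sym (sum-permute (λ x → indicator (P? x)) π)

module _ {n : ℕ} where

  open DecMembership (_≟_ {n}) using (_∈?_)

  count-∈ : (xs : List (Fin n)) → Unique xs → count (_∈? xs) ≡ length xs
  count-∈ []       _          = count-∅ (_∈? []) λ _ ()
  count-∈ (y ∷ xs) (y∉ ∷ xs!) = begin
    count (_∈? (y ∷ xs))                        ≡⟨ count-split (_∈? (y ∷ xs)) (_≟ y) y∈ ⟩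
    count (y∷xs∖y?) + count (_≟ y)              ≡⟨ cong₂ _+_ xs-count (count-≟ y) ⟩
    length xs + 1                               ≡⟨ +-comm (length xs) 1 ⟩
    suc (length xs)                             ∎
    where
    open ≡-Reasoning
    y∈ : ∀ {x} → x ≡ y → x ∈ y ∷ xs
    y∈ refl = here refl
    y∷xs∖y? : Decidable λ x → x ∈ y ∷ xs × ¬ x ≡ y
    y∷xs∖y? = (_∈? (y ∷ xs)) ∩? ∁? (_≟ y)
    drop-y : ∀ {x} → x ∈ y ∷ xs × ¬ x ≡ y → x ∈ xs
    drop-y (here x≡y , x≢y) = contradiction x≡y x≢y
    drop-y (there x∈ , _)   = x∈
    add-y : ∀ {x} → x ∈ xs → x ∈ y ∷ xs × ¬ x ≡ y
    add-y x∈ = there x∈ , λ { refl → All¬⇒¬Any y∉ x∈ }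
    xs-count : count y∷xs∖y? ≡ length xs
    xs-count = trans (count-cong y∷xs∖y? (_∈? xs) drop-y add-y) (count-∈ xs xs!)

  HasSize-count : ∀ {Q R : Fin n → Set} {k} → HasSize Q k →
                  (R? : Decidable R) → Q ⊆ R → R ⊆ Q → count R? ≡ k
  HasSize-count {k = k} (xs , xs! , Q⇔∈ , len) R? Q⊆R R⊆Q = begin
    count R?        ≡⟨ count-cong R? (_∈? xs) (Equivalence.to (Q⇔∈ _) ∘ R⊆Q)
                                              (Q⊆R ∘ Equivalence.from (Q⇔∈ _)) ⟩
    count (_∈? xs)  ≡⟨ count-∈ xs xs! ⟩
    length xs       ≡⟨ len ⟩
    k               ∎
    where open ≡-Reasoning

  HasSize-count-≤ : ∀ {Q R : Fin n → Set} {k} → HasSize Q k →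
                    (R? : Decidable R) → Q ⊆ R → k ≤ count R?
  HasSize-count-≤ (xs , xs! , Q⇔∈ , len) R? Q⊆R =
    subst (_≤ count R?) (trans (count-∈ xs xs!) len)
          (count-mono (_∈? xs) R? (Q⊆R ∘ Equivalence.from (Q⇔∈ _)))

module _ {n : ℕ} {R : Fin n → Fin n → Set} (R? : ∀ x → Decidable (R x))
         (R-sym : ∀ {x y} → R x y → R y x) (R-trans : ∀ {x y z} → R x y → R y z → R x z)
         {b : ℕ} where

  count-uniform-classes : ∀ {O : Fin n → Set} (O? : Decidable O) →
    (∀ {x y} → O x → R x y → O y) → (∀ {x} → O x → R x x) →
    (∀ {x} → O x → count (R? x) ≡ b) → b ∣ count O?
  count-uniform-classes O? = go O? (<-wellFounded (count O?))
    where
    go : ∀ {O : Fin n → Set} (O? : Decidable O) → Acc _<_ (count O?) →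
         (∀ {x y} → O x → R x y → O y) → (∀ {x} → O x → R x x) →
         (∀ {x} → O x → count (R? x) ≡ b) → b ∣ count O?
    go {O} O? (acc rec) closed reflexive size with any? O?
    ... | no ∄x        = subst (b ∣_) (sym (count-∅ O? λ x Ox → ∄x (x , Ox))) (b ∣0)
    ... | yes (x , Ox) = subst (b ∣_) (sym (count-split O? (R? x) (closed Ox)))
                           (∣m∣n⇒∣m+n rest (subst (b ∣_) (sym (size Ox)) ∣-refl))
      where
      smaller : count (O? ∩? ∁? (R? x)) < count O?
      smaller = count-mono-< (O? ∩? ∁? (R? x)) O? proj₁ Ox λ (_ , ¬Rxx) → ¬Rxx (reflexive Ox)
      closed′ : ∀ {y w} → O y × ¬ R x y → R y w → O w × ¬ R x w
      closed′ (Oy , ¬Rxy) Ryw = closed Oy Ryw , λ Rxw → ¬Rxy (R-trans Rxw (R-sym Ryw))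
      rest : b ∣ count (O? ∩? ∁? (R? x))
      rest = go (O? ∩? ∁? (R? x)) (rec smaller) closed′ (reflexive ∘ proj₁) (size ∘ proj₁)

Image : {A B : Set} → (A → Set) → (A → B) → B → Set
Image P f b = ∃ λ a → P a × f a ≡ b

Unique-map⁺ : {A B : Set} (f : A → B) {xs : List A} →
  (∀ {a b} → a ∈ xs → b ∈ xs → f a ≡ f b → a ≡ b) → Unique xs → Unique (map f xs)
Unique-map⁺ f inj []         = []
Unique-map⁺ f inj (a∉ ∷ xs!) =
  All-map⁺ (All.tabulate λ b∈ fa≡fb → All.lookup a∉ b∈ (inj (here refl) (there b∈) fa≡fb))
  ∷ Unique-map⁺ f (λ a∈ b∈ → inj (there a∈) (there b∈)) xs!

HasSize-image : {A B : Set} {P : A → Set} {k : ℕ} (f : A → B) →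
  (∀ {a b} → P a → P b → f a ≡ f b → a ≡ b) → HasSize P k → HasSize (Image P f) k
HasSize-image {P = P} f inj (xs , xs! , P⇔∈ , len) =
  map f xs ,
  Unique-map⁺ f (λ a∈ b∈ → inj (∈⇒P a∈) (∈⇒P b∈)) xs! ,
  (λ b → mk⇔ (λ { (a , Pa , refl) → ∈-map⁺ f (Equivalence.to (P⇔∈ a) Pa) })
             (λ b∈ → let a , a∈ , b≡fa = ∈-map⁻ f b∈ in a , ∈⇒P a∈ , sym b≡fa)) ,
  trans (length-map f xs) len
  where
  ∈⇒P : ∀ {a} → a ∈ xs → P a
  ∈⇒P {a} = Equivalence.from (P⇔∈ a)

module _ {n : ℕ} (c : Permutation′ n) where

  private
    iterate : Fin n → ℕ → Fin n
    iterate x i = fold x (c ⟨$⟩ʳ_) i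

    iterate-injective : ∀ i {x y} → iterate x i ≡ iterate y i → x ≡ y
    iterate-injective zero    eq = eq
    iterate-injective (suc i) {x} {y} eq = iterate-injective i (begin
      iterate x i                  ≡⟨ sym (inverseˡ c) ⟩
      c ⟨$⟩ˡ (c ⟨$⟩ʳ iterate x i)  ≡⟨ cong (c ⟨$⟩ˡ_) eq ⟩
      c ⟨$⟩ˡ (c ⟨$⟩ʳ iterate y i)  ≡⟨ inverseˡ c ⟩
      iterate y i                  ∎)
      where open ≡-Reasoning

    period : ∀ x → ∃ λ d → iterate x (suc d) ≡ x
    period x with pigeonhole (n<1+n n) (λ i → iterate x (toℕ i))
    ... | i , j , i<j , eq = d , iterate-injective (toℕ i) (sym (begin
      iterate x (toℕ i)                    ≡⟨ eq ⟩
      iterate x (toℕ j)                    ≡⟨ cong (iterate x) (sym j≡i+d+1) ⟩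
      iterate x (toℕ i + suc d)            ≡⟨ fold-+ x (c ⟨$⟩ʳ_) (toℕ i) ⟩
      iterate (iterate x (suc d)) (toℕ i)  ∎))
      where
      open ≡-Reasoning
      d : ℕ
      d = toℕ j ∸ suc (toℕ i)
      j≡i+d+1 : toℕ i + suc d ≡ toℕ j
      j≡i+d+1 = trans (+-suc (toℕ i) d) (m+[n∸m]≡n i<j)

  -- Some iterate c^{d+1} fixes x, so c⁻¹ x is the forward iterate c^d x.
  inverse-preserves : {Q : Fin n → Set} → (∀ {x} → Q x → Q (c ⟨$⟩ʳ x)) →
                      ∀ {x} → Q x → Q (c ⟨$⟩ˡ x)
  inverse-preserves {Q} preserves {x} Qx with period x
  ... | d , cycle =
    subst Q (trans (sym (inverseˡ c)) (cong (c ⟨$⟩ˡ_) cycle)) (iterate-preserves d Qx)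
    where
    iterate-preserves : ∀ i {y} → Q y → Q (iterate y i)
    iterate-preserves zero    Qy = Qy
    iterate-preserves (suc i) Qy = preserves (iterate-preserves i Qy)

module Action (Γ : Graph) where

  infixl 8 _^_
  _^_ : Fin (Graph.N Γ) → Perm Γ → Fin (Graph.N Γ)
  _^_ = Defs._^_ Γ

  ^-inverseˡ : ∀ x a → x ^ a ^ flip a ≡ x
  ^-inverseˡ x a = inverseˡ a

  ^-inverseʳ : ∀ x a → x ^ flip a ^ a ≡ x
  ^-inverseʳ x a = inverseʳ a

  ^-injective : ∀ a {x y} → x ^ a ≡ y ^ a → x ≡ y
  ^-injective a {x} {y} eq =
    trans (sym (^-inverseˡ x a)) (trans (cong (_^ flip a) eq) (^-inverseˡ y a))

  fixed-flip : ∀ {x a} → x ^ a ≡ x → x ^ flip a ≡ x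
  fixed-flip {x} {a} eq = trans (cong (_^ flip a) (sym eq)) (^-inverseˡ x a)

  flip-≈ : ∀ {a b} → _≈_ Γ a b → _≈_ Γ (flip a) (flip b)
  flip-≈ {a} {b} a≈b w =
    ^-injective b (trans (sym (a≈b _)) (trans (^-inverseʳ w a) (sym (^-inverseʳ w b))))

record IsSubgroup (Γ : Graph) (Q : Perm Γ → Set) : Set where
  field
    resp   : ∀ {g h} → _≈_ Γ g h → Q g → Q h
    hasId  : Q id
    closed : ∀ {g h} → Q g → Q h → Q (g ∘ₚ h)
    inv    : ∀ {g} → Q g → Q (flip g)

Gen-least : ∀ {Γ H K Q} → IsSubgroup Γ Q → H ⊆ Q → K ⊆ Q → Gen Γ H K ⊆ Q
Gen-least {Γ} {H} {K} {Q} Q-subgroup H⊆Q K⊆Q = go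
  where
  open IsSubgroup Q-subgroup
  go : Gen Γ H K ⊆ Q
  go (inH h)       = H⊆Q h
  go (inK k)       = K⊆Q k
  go one           = hasId
  go (mul a b)     = closed (go a) (go b)
  go (invG a)      = inv (go a)
  go (respG a≈b a) = resp a≈b (go a)

StabTail-subgroup : ∀ {Γ G} → IsAutSubgroup Γ G → ∀ v n → IsSubgroup Γ (StabTail Γ G v n)
StabTail-subgroup {Γ} {G} isG v n = record
  { resp   = λ { {a} {b} a≈b (Ga , fa) →
               resp a b a≈b Ga , λ i 1≤i i≤n → trans (sym (a≈b (v i))) (fa i 1≤i i≤n) }
  ; hasId  = hasId , λ _ _ _ → refl
  ; closed = λ { {a} {b} (Ga , fa) (Gb , fb) →
               closed a b Ga Gb , λ i 1≤i i≤n → trans (cong (_^ b) (fa i 1≤i i≤n)) (fb i 1≤i i≤n) }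
  ; inv    = λ { {a} (Ga , fa) → inv a Ga , λ i 1≤i i≤n → fixed-flip {v i} {a} (fa i 1≤i i≤n) }
  }
  where
  open Action Γ
  open IsAutSubgroup isG

module Successors (Γ : Graph) (G : Perm Γ → Set) (v : ℕ → Fin (Graph.N Γ)) where

  open Action Γ

  V : Set
  V = Fin (Graph.N Γ)

  lastEntry : ∀ {n} → Vec V (suc n) → V
  lastEntry {n} s = lookup s (fromℕ n)

  successorEntry : ℕ → V → ℕ → V
  successorEntry n w j with j <? n
  ... | yes _ = v (suc j)
  ... | no _  = w

  successor : (n : ℕ) → V → Vec V (suc n)
  successor n w = tabulate (successorEntry n w ∘ toℕ)

  successor-early : ∀ {n w} (i : Fin (suc n)) → toℕ i < n →
                    lookup (successor n w) i ≡ v (suc (toℕ i))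
  successor-early {n} {w} i i<n with toℕ i <? n | lookup∘tabulate (successorEntry n w ∘ toℕ) i
  ... | yes _  | eq = eq
  ... | no i≮n | _  = contradiction i<n i≮n

  successor-last : ∀ {n w} → lastEntry (successor n w) ≡ w
  successor-last {n} {w}
    with toℕ (fromℕ n) <? n | lookup∘tabulate (successorEntry n w ∘ toℕ) (fromℕ n)
  ... | yes n<n | _  = contradiction (subst (_< n) (toℕ-fromℕ n) n<n) (n≮n n)
  ... | no _    | eq = eq

  successor-Succ : ∀ {n h} → Shunt Γ G v n h → Succ Γ G v n (successor n (v n ^ h))
  successor-Succ {n} {h} h-shunt = h , h-shunt , successor-early , successor-last {n}

  Succ-injective : ∀ {n s s′} → Succ Γ G v n s → Succ Γ G v n s′ →
                   lastEntry s ≡ lastEntry s′ → s ≡ s′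
  Succ-injective {n} {s} {s′} (_ , _ , s-early , _) (_ , _ , s′-early , _) same-last =
    trans (sym (tabulate∘lookup s)) (trans (tabulate-cong entrywise) (tabulate∘lookup s′))
    where
    entrywise : ∀ i → lookup s i ≡ lookup s′ i
    entrywise i with toℕ i <? n
    ... | yes i<n = trans (s-early i i<n) (sym (s′-early i i<n))
    ... | no i≮n  = subst (λ j → lookup s j ≡ lookup s′ j) (sym i≡last) same-last
      where
      i≡last : i ≡ fromℕ n
      i≡last = toℕ-injective (trans (≤-antisym (toℕ≤pred[n] i) (≮⇒≥ i≮n)) (sym (toℕ-fromℕ n)))

module Spread (Γ : Graph) (G : Perm Γ → Set) (isG : IsAutSubgroup Γ G)
              (connected : Connected Γ) (arc-transitive : ArcTransitive Γ G)
              {P : Perm Γ → Set} (P-subgroup : IsSubgroup Γ P)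
              {F : Fin (Graph.N Γ) → Set} (P-preserves-F : ∀ {x w} → P x → F w → F (x ⟨$⟩ʳ w))
              where

  open Action Γ
  open Graph Γ using (Adj)
  open IsSubgroup P-subgroup
  open IsAutSubgroup isG using () renaming (closed to G-closed; inv to G-inv)

  Good : Fin (Graph.N Γ) → Set
  Good u = F u × (∀ {x} → G x → u ^ x ≡ u → P x)

  Good-step : ∀ {u w w′} → Adj u w → Good u → Good w → Adj w w′ → Good w′
  Good-step {u} {w} {w′} u~w (Fu , stab-u⊆P) (Fw , stab-w⊆P) w~w′
    with arc-transitive w u w w′ (Graph.sym Γ u~w) w~w′
  ... | y , Gy , wy≡w , uy≡w′ = subst F uy≡w′ (P-preserves-F Py Fu) , stab-w′⊆P
    where
    Py : P y
    Py = stab-w⊆P Gy wy≡w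
    stab-w′⊆P : ∀ {z} → G z → w′ ^ z ≡ w′ → P z
    stab-w′⊆P {z} Gz w′z≡w′ = resp {flip y ∘ₚ (z′ ∘ₚ y)} {z} unconjugate
      (closed {flip y} {z′ ∘ₚ y} (inv {y} Py) (closed {z′} {y} (stab-u⊆P Gz′ uz′≡u) Py))
      where
      open ≡-Reasoning
      z′ : Perm Γ
      z′ = y ∘ₚ (z ∘ₚ flip y)
      Gz′ : G z′
      Gz′ = G-closed _ _ Gy (G-closed _ _ Gz (G-inv _ Gy))
      uz′≡u : u ^ z′ ≡ u
      uz′≡u = begin
        u ^ y ^ z ^ flip y  ≡⟨ cong (λ q → q ^ z ^ flip y) uy≡w′ ⟩
        w′ ^ z ^ flip y     ≡⟨ cong (_^ flip y) w′z≡w′ ⟩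
        w′ ^ flip y         ≡⟨ cong (_^ flip y) (sym uy≡w′) ⟩
        u ^ y ^ flip y      ≡⟨ ^-inverseˡ u y ⟩
        u                   ∎
      unconjugate : _≈_ Γ (flip y ∘ₚ (z′ ∘ₚ y)) z
      unconjugate q =
        trans (cong (λ q′ → q′ ^ z ^ flip y ^ y) (^-inverseʳ q y)) (^-inverseʳ (q ^ z) y)

  Good-walk : ∀ {u a b} → Star Adj a b → Adj u a → Good u → Good a → Good b
  Good-walk ε          _   _      good-a = good-a
  Good-walk (a~c ◅ as) u~a good-u good-a = Good-walk as a~c good-a (Good-step u~a good-u good-a a~c)

  holds-everywhere : ∀ {u w} → Adj u w → Good u → Good w → ∀ x → F x
  holds-everywhere {w = w} u~w good-u good-w x =
    proj₁ (Good-walk (connected w x) u~w good-u good-w)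

module ShuntedWalk (Γ : Graph) (G : Perm Γ → Set) (isG : IsAutSubgroup Γ G)
  (r : ℕ) (v : ℕ → Fin (Graph.N Γ)) (g : Perm Γ) (g-shunt : Shunt Γ G v r g)
  (successors-fixed : ∀ h → Stab Γ G v r h → ∀ t → Succ Γ G v r t → FixesTuple Γ t h) where

  open Action Γ
  open Successors Γ G v
  open IsAutSubgroup isG using () renaming (closed to G-closed; inv to G-inv)

  g∈G : G g
  g∈G = proj₁ g-shunt

  g-shifts : ∀ {i} → i < r → v i ^ g ≡ v (suc i)
  g-shifts = proj₂ g-shunt _

  g⁻¹-shifts : ∀ {i} → i < r → v (suc i) ^ flip g ≡ v i
  g⁻¹-shifts {i} i<r = trans (cong (_^ flip g) (sym (g-shifts i<r))) (^-inverseˡ (v i) g)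

  g-shunt-≤ : ∀ {n} → n ≤ r → Shunt Γ G v n g
  g-shunt-≤ n≤r = g∈G , λ i i<n → g-shifts (<-≤-trans i<n n≤r)

  StabTail-shunt : ∀ {n t} → n ≤ r → StabTail Γ G v n t → Shunt Γ G v n (g ∘ₚ t)
  StabTail-shunt {t = t} n≤r (Gt , ft) = G-closed _ _ g∈G Gt , λ i i<n →
    trans (cong (_^ t) (g-shifts (<-≤-trans i<n n≤r))) (ft (suc i) (s≤s z≤n) i<n)

  Shunt-StabTail : ∀ {n h} → n ≤ r → Shunt Γ G v n h → StabTail Γ G v n (flip g ∘ₚ h)
  Shunt-StabTail {n} {h} n≤r (Gh , h-shifts) = G-closed _ _ (G-inv _ g∈G) Gh , fixes
    where
    fixes : ∀ i → 1 ≤ i → i ≤ n → v i ^ flip g ^ h ≡ v i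
    fixes (suc j) _ j<n = trans (cong (_^ h) (g⁻¹-shifts (<-≤-trans j<n n≤r))) (h-shifts j j<n)

  StabImage-conj : ∀ {n y} → StabImage Γ G v n g y → Stab Γ G v n (g ∘ₚ (y ∘ₚ flip g))
  StabImage-conj (Gy , fy) = G-closed _ _ g∈G (G-closed _ _ Gy (G-inv _ g∈G)) , λ i i≤n →
    trans (cong (_^ flip g) (fy i i≤n)) (^-inverseˡ (v i) g)

  Stab-conj : ∀ {m x} → suc m ≤ r → Stab Γ G v m x → StabTail Γ G v (suc m) (flip g ∘ₚ (x ∘ₚ g))
  Stab-conj {m} {x} m<r (Gx , fx) = G-closed _ _ (G-inv _ g∈G) (G-closed _ _ Gx g∈G) , fixes
    where
    fixes : ∀ i → 1 ≤ i → i ≤ suc m → v i ^ flip g ^ x ^ g ≡ v i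
    fixes (suc j) _ (s≤s j≤m) = begin
      v (suc j) ^ flip g ^ x ^ g  ≡⟨ cong (λ u → u ^ x ^ g) (g⁻¹-shifts (≤-<-trans j≤m m<r)) ⟩
      v j ^ x ^ g                 ≡⟨ cong (_^ g) (fx j j≤m) ⟩
      v j ^ g                     ≡⟨ g-shifts (≤-<-trans j≤m m<r) ⟩
      v (suc j)                   ∎
      where open ≡-Reasoning

  StabImage⊆StabTail : ∀ {m} → suc m ≤ r → StabImage Γ G v m g ⊆ StabTail Γ G v (suc m)
  StabImage⊆StabTail {m} m<r {y} (Gy , fy) = Gy , fixes
    where
    fixes : ∀ i → 1 ≤ i → i ≤ suc m → v i ^ y ≡ v i
    fixes (suc j) _ (s≤s j≤m) = subst (λ u → u ^ y ≡ u) (g-shifts (≤-<-trans j≤m m<r)) (fy j j≤m)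

  Kernel : Perm Γ → Set
  Kernel = Stab Γ G v r

  Fixed : V → Set
  Fixed w = ∀ {h} → Kernel h → w ^ h ≡ w

  MapsFixed : Perm Γ → Set
  MapsFixed c = ∀ {w} → Fixed w → Fixed (w ^ c)

  PermutesFixed : Perm Γ → Set
  PermutesFixed c = MapsFixed c × MapsFixed (flip c)

  PermutesFixed-subgroup : IsSubgroup Γ PermutesFixed
  PermutesFixed-subgroup = record
    { resp   = λ { {a} {b} a≈b (a↦ , a⁻¹↦) →
                 (λ {w} Fw → subst Fixed (a≈b w) (a↦ Fw)) ,
                 (λ {w} Fw → subst Fixed (flip-≈ {a} {b} a≈b w) (a⁻¹↦ Fw)) }
    ; hasId  = (λ Fw → Fw) , (λ Fw → Fw)
    ; closed = λ { (a↦ , a⁻¹↦) (b↦ , b⁻¹↦) → b↦ ∘ a↦ , a⁻¹↦ ∘ b⁻¹↦ }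
    ; inv    = λ { (a↦ , a⁻¹↦) → a⁻¹↦ , a↦ }
    }

  vertex-fixed : ∀ {i} → i ≤ r → Fixed (v i)
  vertex-fixed i≤r Kh = proj₂ Kh _ i≤r

  Shunt-image-fixed : ∀ {h i} → Shunt Γ G v r h → i ≤ r → Fixed (v i ^ h)
  Shunt-image-fixed {h} {i} h-shunt i≤r {k} Kk with m≤n⇒m<n∨m≡n i≤r
  ... | inj₁ i<r  = subst (λ u → u ^ k ≡ u) (sym (proj₂ h-shunt i i<r)) (vertex-fixed i<r Kk)
  ... | inj₂ refl = subst (λ u → u ^ k ≡ u) (successor-last {r})
    (successors-fixed k Kk (successor r (v r ^ h)) (successor-Succ h-shunt) (fromℕ r))

  conj-maps-fixed : ∀ c → (∀ {y} → Kernel y → Kernel (c ∘ₚ (y ∘ₚ flip c))) → MapsFixed c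
  conj-maps-fixed c conj {w} Fw Ky =
    ^-injective (flip c) (trans (Fw (conj Ky)) (sym (^-inverseˡ w c)))

  g-permutes-fixed : PermutesFixed g
  g-permutes-fixed = g-maps-fixed , inverse-preserves g {Fixed} g-maps-fixed
    where
    g-maps-fixed : MapsFixed g
    g-maps-fixed = conj-maps-fixed g λ Ky →
      StabImage-conj (proj₁ Ky , λ i i≤r → Shunt-image-fixed g-shunt i≤r Ky)

  StabImage⊆Kernel : StabImage Γ G v r g ⊆ Kernel
  StabImage⊆Kernel {z} Sz = proj₁ Sz , λ i i≤r → ^-injective (flip g) (begin
    v i ^ z ^ flip g               ≡⟨ cong (λ u → u ^ z ^ flip g) (sym (^-inverseʳ (v i) g)) ⟩
    v i ^ flip g ^ g ^ z ^ flip g  ≡⟨ proj₂ g-permutes-fixed (vertex-fixed i≤r) (StabImage-conj Sz) ⟩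
    v i ^ flip g                   ∎)
    where open ≡-Reasoning

  StabTail-r⊆PermutesFixed : StabTail Γ G v r ⊆ PermutesFixed
  StabTail-r⊆PermutesFixed Tt =
    maps-fixed Tt , maps-fixed (IsSubgroup.inv (StabTail-subgroup isG v r) Tt)
    where
    maps-fixed : ∀ {t} → StabTail Γ G v r t → MapsFixed t
    maps-fixed {t} (Gt , ft) = conj-maps-fixed t λ {y} Ky → StabImage⊆Kernel
      ( G-closed _ _ Gt (G-closed _ _ (proj₁ Ky) (G-inv _ Gt))
      , λ i i≤r → trans (cong (_^ flip t) (Shunt-image-fixed gt-shunt i≤r Ky)) (^-inverseˡ (v i ^ g) t))
      where
      gt-shunt : Shunt Γ G v r (g ∘ₚ t)
      gt-shunt = StabTail-shunt ≤-refl (Gt , ft)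

  GenStab : ℕ → Perm Γ → Set
  GenStab m = Gen Γ (Stab Γ G v m) (StabImage Γ G v m g)

  ConditionABC : ℕ → ℕ → ℕ → Set
  ConditionABC m kₘ kₘ₊₁ =
    (¬ (∃ λ i → (kₘ₊₁ ≤ i) × (i < kₘ) × (i ∣ kₘ)))
    ⊎ TransitiveOn Γ (GenStab m) (Succ Γ G v m)
    ⊎ SameSet Γ (GenStab m) (StabTail Γ G v m)

  Gen⊆PermutesFixed : ∀ {m} → suc m ≤ r →
                      StabTail Γ G v (suc m) ⊆ PermutesFixed → GenStab m ⊆ PermutesFixed
  Gen⊆PermutesFixed {m} m<r T⊆P =
    Gen-least PermutesFixed-subgroup Stab⊆P (λ Sy → T⊆P (StabImage⊆StabTail m<r Sy))
    where
    open IsSubgroup PermutesFixed-subgroup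
    Stab⊆P : Stab Γ G v m ⊆ PermutesFixed
    Stab⊆P {x} Sx = resp {g ∘ₚ (y ∘ₚ flip g)} {x} unconjugate
      (closed {g} {y ∘ₚ flip g} g-permutes-fixed
              (closed {y} {flip g} (T⊆P (Stab-conj m<r Sx)) (inv {g} g-permutes-fixed)))
      where
      y : Perm Γ
      y = flip g ∘ₚ (x ∘ₚ g)
      unconjugate : _≈_ Γ (g ∘ₚ (y ∘ₚ flip g)) x
      unconjugate w =
        trans (cong (λ u → u ^ x ^ g ^ flip g) (^-inverseˡ w g)) (^-inverseˡ (w ^ x) g)

  module Step (m : ℕ) (m<r : m < r) where

    M : Perm Γ → Set
    M = GenStab m

    T : Perm Γ → Set
    T = StabTail Γ G v m

    open IsSubgroup (StabTail-subgroup isG v m) using () renaming (closed to T-closed; inv to T-inv)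

    p : V
    p = v m ^ g

    Gen⊆StabTail : M ⊆ T
    Gen⊆StabTail = Gen-least (StabTail-subgroup isG v m) Stab⊆T StabImage⊆T
      where
      Stab⊆T : Stab Γ G v m ⊆ T
      Stab⊆T (Gx , fx) = Gx , λ i _ i≤m → fx i i≤m
      StabImage⊆T : StabImage Γ G v m g ⊆ T
      StabImage⊆T Sy with StabImage⊆StabTail m<r Sy
      ... | Gy , fy = Gy , λ i 1≤i i≤m → fy i 1≤i (m≤n⇒m≤1+n i≤m)

    StabTail-fixing-p : ∀ {t} → T t → p ^ t ≡ p → StabImage Γ G v m g t
    StabTail-fixing-p {t} (Gt , ft) pt≡p = Gt , fixes
      where
      fixes : ∀ i → i ≤ m → v i ^ g ^ t ≡ v i ^ g
      fixes i i≤m with m≤n⇒m<n∨m≡n i≤m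
      ... | inj₁ i<m  = subst (λ u → u ^ t ≡ u) (sym (g-shifts (<-trans i<m m<r)))
                              (ft (suc i) (s≤s z≤n) i<m)
      ... | inj₂ refl = pt≡p

    Orbit : V → Set
    Orbit = Image T (p ^_)

    GenOrbit : V → Set
    GenOrbit = Image M (p ^_)

    GenOrbit⊆Orbit : GenOrbit ⊆ Orbit
    GenOrbit⊆Orbit (μ , Mμ , pμ≡) = μ , Gen⊆StabTail Mμ , pμ≡

    covered⇒StabTail⊆Gen : (∀ {t} → T t → GenOrbit (p ^ t)) → T ⊆ M
    covered⇒StabTail⊆Gen covered {t} Tt with covered Tt
    ... | μ , Mμ , pμ≡pt =
      respG (λ w → ^-inverseʳ (w ^ t) μ) (mul (inK (StabTail-fixing-p Ts ps)) Mμ)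
      where
      Ts : T (t ∘ₚ flip μ)
      Ts = T-closed Tt (T-inv (Gen⊆StabTail Mμ))
      ps : p ^ t ^ flip μ ≡ p
      ps = trans (cong (_^ flip μ) (sym pμ≡pt)) (^-inverseˡ p μ)

    transitive⇒covered : TransitiveOn Γ M (Succ Γ G v m) → ∀ {t} → T t → GenOrbit (p ^ t)
    transitive⇒covered M-transitive {t} Tt
      with M-transitive (successor m p) (successor m (p ^ t))
                        (successor-Succ (g-shunt-≤ (<⇒≤ m<r)))
                        (successor-Succ (StabTail-shunt (<⇒≤ m<r) Tt))
    ... | μ , Mμ , moves =
      μ , Mμ , trans (cong (_^ μ) (sym (successor-last {m})))
                     (trans (moves (fromℕ m)) (successor-last {m}))

    Orbit-base : ∀ {a x} → T a → p ^ a ≡ x → GenOrbit (x ^ flip a)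
    Orbit-base {a} _ pa≡x = id , one , sym (trans (cong (_^ flip a) (sym pa≡x)) (^-inverseˡ p a))

    -- The T-translates of GenOrbit are blocks of imprimitivity partitioning Orbit; Linked x w
    -- says that x and w lie in the same block.
    Linked : V → V → Set
    Linked x w = ∃ λ t → T t × GenOrbit (x ^ flip t) × GenOrbit (w ^ flip t)

    Linked-translate : ∀ {a x w} → T a → p ^ a ≡ x → Linked x w → GenOrbit (w ^ flip a)
    Linked-translate {a} {x} {w} Ta pa≡x (t , Tt , (μ₁ , Mμ₁ , pμ₁≡) , (μ₂ , Mμ₂ , pμ₂≡)) =
      μ₂ ∘ₚ (flip μ₁ ∘ₚ s) , mul Mμ₂ (mul (invG Mμ₁) (inK (StabTail-fixing-p Ts ps))) , moves
      where
      open ≡-Reasoning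
      s : Perm Γ
      s = μ₁ ∘ₚ (t ∘ₚ flip a)
      Ts : T s
      Ts = T-closed (Gen⊆StabTail Mμ₁) (T-closed Tt (T-inv Ta))
      ps : p ^ s ≡ p
      ps = begin
        p ^ μ₁ ^ t ^ flip a      ≡⟨ cong (λ u → u ^ t ^ flip a) pμ₁≡ ⟩
        x ^ flip t ^ t ^ flip a  ≡⟨ cong (_^ flip a) (^-inverseʳ x t) ⟩
        x ^ flip a               ≡⟨ cong (_^ flip a) (sym pa≡x) ⟩
        p ^ a ^ flip a           ≡⟨ ^-inverseˡ p a ⟩
        p                        ∎
      moves : p ^ (μ₂ ∘ₚ (flip μ₁ ∘ₚ s)) ≡ w ^ flip a
      moves = begin
        p ^ μ₂ ^ flip μ₁ ^ μ₁ ^ t ^ flip a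
          ≡⟨ cong (λ u → u ^ flip μ₁ ^ μ₁ ^ t ^ flip a) pμ₂≡ ⟩
        w ^ flip t ^ flip μ₁ ^ μ₁ ^ t ^ flip a
          ≡⟨ cong (λ u → u ^ t ^ flip a) (^-inverseʳ (w ^ flip t) μ₁) ⟩
        w ^ flip t ^ t ^ flip a
          ≡⟨ cong (_^ flip a) (^-inverseʳ w t) ⟩
        w ^ flip a
          ∎

    Linked-translate⁻ : ∀ {a x w} → T a → p ^ a ≡ x → GenOrbit (w ^ flip a) → Linked x w
    Linked-translate⁻ {a} Ta pa≡x Bw = a , Ta , Orbit-base Ta pa≡x , Bw

    Linked-sym : ∀ {x w} → Linked x w → Linked w x
    Linked-sym (t , Tt , Bx , Bw) = t , Tt , Bw , Bx

    Linked⇒Orbit : ∀ {x w} → Linked x w → Orbit w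
    Linked⇒Orbit {w = w} (t , Tt , _ , (μ , Mμ , pμ≡)) =
      μ ∘ₚ t , T-closed (Gen⊆StabTail Mμ) Tt , trans (cong (_^ t) pμ≡) (^-inverseʳ w t)

    Linked-trans : ∀ {x y z} → Linked x y → Linked y z → Linked x z
    Linked-trans x~y y~z with Linked⇒Orbit x~y
    ... | a , Ta , pa≡y =
      a , Ta , Linked-translate Ta pa≡y (Linked-sym x~y) , Linked-translate Ta pa≡y y~z

    Linked-refl : ∀ {x} → Orbit x → Linked x x
    Linked-refl (a , Ta , pa≡x) = Linked-translate⁻ Ta pa≡x (Orbit-base Ta pa≡x)

    module Counting (Orbit? : Decidable Orbit) (GenOrbit? : Decidable GenOrbit)
                    (Linked? : ∀ x → Decidable (Linked x)) where

      count-Orbit : ∀ {k} → HasSize (Succ Γ G v m) k → count Orbit? ≡ k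
      count-Orbit size =
        HasSize-count (HasSize-image lastEntry Succ-injective size) Orbit? Image⊆Orbit Orbit⊆Image
        where
        Image⊆Orbit : Image (Succ Γ G v m) lastEntry ⊆ Orbit
        Image⊆Orbit (s , (h , h-shunt , _ , last≡) , refl) =
          flip g ∘ₚ h , Shunt-StabTail (<⇒≤ m<r) h-shunt ,
          trans (cong (_^ h) (^-inverseˡ (v m) g)) (sym last≡)
        Orbit⊆Image : Orbit ⊆ Image (Succ Γ G v m) lastEntry
        Orbit⊆Image (t , Tt , refl) =
          successor m (p ^ t) , successor-Succ (StabTail-shunt (<⇒≤ m<r) Tt) , successor-last {m}

      count-GenOrbit-≥ : ∀ {k} → HasSize (Succ Γ G v (suc m)) k → k ≤ count GenOrbit?
      count-GenOrbit-≥ size =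
        HasSize-count-≤ (HasSize-image back injective size) GenOrbit? Image⊆GenOrbit
        where
        back : Vec V (suc (suc m)) → V
        back s = lastEntry s ^ flip g
        injective : ∀ {s s′} → Succ Γ G v (suc m) s → Succ Γ G v (suc m) s′ →
                    back s ≡ back s′ → s ≡ s′
        injective Ss Ss′ eq = Succ-injective Ss Ss′ (^-injective (flip g) eq)
        Image⊆GenOrbit : Image (Succ Γ G v (suc m)) back ⊆ GenOrbit
        Image⊆GenOrbit (s , (h , (Gh , h-shifts) , _ , last≡) , refl) =
          h ∘ₚ flip g , inH (G-closed _ _ Gh (G-inv _ g∈G) , fixes) , (begin
            v m ^ g ^ h ^ flip g    ≡⟨ cong (λ u → u ^ h ^ flip g) (g-shifts m<r) ⟩
            v (suc m) ^ h ^ flip g  ≡⟨ cong (_^ flip g) (sym last≡) ⟩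
            lastEntry s ^ flip g    ∎)
          where
          open ≡-Reasoning
          fixes : ∀ i → i ≤ m → v i ^ h ^ flip g ≡ v i
          fixes i i≤m =
            trans (cong (_^ flip g) (h-shifts i (s≤s i≤m))) (g⁻¹-shifts (≤-<-trans i≤m m<r))

      count-Linked : ∀ {x} → Orbit x → count (Linked? x) ≡ count GenOrbit?
      count-Linked {x} (a , Ta , pa≡x) = begin
        count (Linked? x)                      ≡⟨ count-cong (Linked? x) (λ w → GenOrbit? (w ^ flip a))
                                                     (Linked-translate Ta pa≡x)
                                                     (Linked-translate⁻ Ta pa≡x) ⟩
        count (λ w → GenOrbit? (w ^ flip a))  ≡⟨ count-permute GenOrbit? (flip a) ⟩
        count GenOrbit?                        ∎
        where open ≡-Reasoning

      count-GenOrbit-∣ : count GenOrbit? ∣ count Orbit?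
      count-GenOrbit-∣ = count-uniform-classes Linked? Linked-sym Linked-trans
                           Orbit? (λ _ → Linked⇒Orbit) Linked-refl count-Linked

      no-divisor⇒covered : ∀ {kₘ kₘ₊₁} →
        HasSize (Succ Γ G v m) kₘ → HasSize (Succ Γ G v (suc m)) kₘ₊₁ →
        ¬ (∃ λ i → (kₘ₊₁ ≤ i) × (i < kₘ) × (i ∣ kₘ)) → ∀ {t} → T t → GenOrbit (p ^ t)
      no-divisor⇒covered size size′ no-divisor {t} Tt with GenOrbit? (p ^ t)
      ... | yes covered = covered
      ... | no ¬covered = contradiction
        ( count GenOrbit?
        , count-GenOrbit-≥ size′
        , subst (count GenOrbit? <_) (count-Orbit size)
                (count-mono-< GenOrbit? Orbit? GenOrbit⊆Orbit (t , Tt , refl) ¬covered)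
        , subst (count GenOrbit? ∣_) (count-Orbit size) count-GenOrbit-∣ )
        no-divisor

    StabTail⊆Gen : ∀ {kₘ kₘ₊₁} → HasSize (Succ Γ G v m) kₘ → HasSize (Succ Γ G v (suc m)) kₘ₊₁ →
                   ConditionABC m kₘ kₘ₊₁ → DoubleNegation (T ⊆ M)
    StabTail⊆Gen size size′ (inj₁ no-divisor) = do
      Orbit?    ← ¬¬-decidable Orbit
      GenOrbit? ← ¬¬-decidable GenOrbit
      Linked?   ← ¬¬-∀-Fin λ x → ¬¬-decidable (Linked x)
      pure λ {t} → covered⇒StabTail⊆Gen
        (Counting.no-divisor⇒covered Orbit? GenOrbit? Linked? size size′ no-divisor) {t}
    StabTail⊆Gen _ _ (inj₂ (inj₁ M-transitive)) =
      pure λ {t} → covered⇒StabTail⊆Gen (transitive⇒covered M-transitive) {t}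
    StabTail⊆Gen _ _ (inj₂ (inj₂ M≡T)) =
      pure λ {t} Tt → Equivalence.from (M≡T t) Tt

  module Descent (k : ℕ → ℕ) (sizes : ∀ n → 1 ≤ n → n ≤ r → HasSize (Succ Γ G v n) (k n))
    (conditions : ∀ n → 1 ≤ n → n < r → ConditionABC n (k n) (k (suc n))) where

    StabTail⊆PermutesFixed : ∀ d {n} → 1 ≤ n → n + d ≡ r →
                             DoubleNegation (StabTail Γ G v n ⊆ PermutesFixed)
    StabTail⊆PermutesFixed zero {n} _ n+0≡r = pure λ {t} Tt →
      StabTail-r⊆PermutesFixed (subst (λ q → StabTail Γ G v q t) n≡r Tt)
      where
      n≡r : n ≡ r
      n≡r = trans (sym (+-identityʳ n)) n+0≡r
    StabTail⊆PermutesFixed (suc d) {n} 1≤n n+d+1≡r = do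
      T′⊆P ← StabTail⊆PermutesFixed d (s≤s z≤n) (trans (sym (+-suc n d)) n+d+1≡r)
      T⊆M  ← Step.StabTail⊆Gen n n<r (sizes n 1≤n (<⇒≤ n<r)) (sizes (suc n) (s≤s z≤n) n<r)
                                     (conditions n 1≤n n<r)
      pure λ {t} Tt → Gen⊆PermutesFixed n<r T′⊆P (T⊆M Tt)
      where
      n<r : n < r
      n<r = subst (suc n ≤_) (trans (sym (+-suc n d)) n+d+1≡r) (s≤s (m≤m+n n d))

  Fixed-everywhere : Connected Γ → ArcTransitive Γ G → IsWalk Γ v r → 1 ≤ r →
                     StabTail Γ G v 1 ⊆ PermutesFixed → ∀ x → Fixed x
  Fixed-everywhere connected arc-transitive walk 1≤r T₁⊆P =
    holds-everywhere (Graph.sym Γ (walk 0 1≤r))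
                     (vertex-fixed 1≤r , stab-v₁⊆P) (vertex-fixed z≤n , stab-v₀⊆P)
    where
    open Spread Γ G isG connected arc-transitive PermutesFixed-subgroup {Fixed} (λ Px Fw → proj₁ Px Fw)
    stab-v₁⊆P : ∀ {x} → G x → v 1 ^ x ≡ v 1 → PermutesFixed x
    stab-v₁⊆P Gx fixes = T₁⊆P (Gx , λ { (suc zero) _ _ → fixes ; (suc (suc _)) _ (s≤s ()) })
    stab-v₀⊆P : ∀ {x} → G x → v 0 ^ x ≡ v 0 → PermutesFixed x
    stab-v₀⊆P Gx fixes = Gen⊆PermutesFixed 1≤r T₁⊆P (inH (Gx , λ { zero _ → fixes }))

corollary3p9 : (Γ : Graph) → Connected Γ →
    (G : Perm Γ → Set) → IsAutSubgroup Γ G → ArcTransitive Γ G →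
    (r : ℕ) → 1 ≤ r →
    (v : ℕ → Fin (Graph.N Γ)) → IsWalk Γ v r →
    (g : Perm Γ) → Shunt Γ G v r g →
    (k : ℕ → ℕ) → (∀ n → 1 ≤ n → n ≤ r → HasSize (Succ Γ G v n) (k n)) →
    (∀ h → Stab Γ G v r h → ∀ t → Succ Γ G v r t → FixesTuple Γ t h) →
    (∀ n → 1 ≤ n → n < r →
       (¬ (∃ λ i → (k (suc n) ≤ i) × (i < k n) × (i ∣ k n)))
       ⊎ TransitiveOn Γ (Gen Γ (Stab Γ G v n) (StabImage Γ G v n g)) (Succ Γ G v n)
       ⊎ SameSet Γ (Gen Γ (Stab Γ G v n) (StabImage Γ G v n g)) (StabTail Γ G v n)) →
    ∀ h → Stab Γ G v r h → _≈_ Γ h id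
corollary3p9 Γ connected G isG arc-transitive r 1≤r v walk g g-shunt k sizes successors-fixed
             conditions h h∈Gα x =
  decidable-stable (x ^ h ≟ x) (¬¬-map x-fixed T₁⊆P)
  where
  open Action Γ
  open ShuntedWalk Γ G isG r v g g-shunt successors-fixed
  T₁⊆P : DoubleNegation (StabTail Γ G v 1 ⊆ PermutesFixed)
  T₁⊆P = Descent.StabTail⊆PermutesFixed k sizes conditions (r ∸ 1) (s≤s z≤n) (m+[n∸m]≡n 1≤r)
  x-fixed : StabTail Γ G v 1 ⊆ PermutesFixed → x ^ h ≡ x
  x-fixed T₁⊆P = Fixed-everywhere connected arc-transitive walk 1≤r T₁⊆P x h∈Gα
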